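{- (Main Lemma) For every PCF type $\sigma$ and every PCF term $t$ of type $\sigma$, we have $t\,R_\sigma\,[\![t]\!]$.
   Context: Ambient theory: intensional Martin-Löf type theory with function extensionality, propositional extensionality and propositional truncation $\|-\|$. There are universes $\mathcal U_0:\mathcal U_1$, and $\Omega$ is the type of propositions in $\mathcal U_0$. PCF types are $\iota$ and $\sigma\Rightarrow\tau$. PCF terms are generated inductively by the following constants and application: - $\mathsf{zero}:\iota$; - $\mathsf{succ},\mathsf{pred}:\iota\Rightarrow\iota$; - $\mathsf{ifz}:\iota\Rightarrow\iota\Rightarrow\iota\Rightarrow\iota$; - $\mathsf k_{\sigma,\tau}:\sigma\Rightarrow\tau\Rightarrow\sigma$; - $\mathsf s_{\sigma,\tau,\rho}:(\sigma\Rightarrow\tau\Rightarrow\rho)\Rightarrow(\sigma\Rightarrow\tau)\Rightarrow\sigma\Rightarrow\rho$; - $\mathsf{fix}_\sigma:(\sigma\Rightarrow\sigma)\Rightarrow\sigma$; - application $st$. Numerals: $\underline0=\mathsf{zero}$ and $\underline{n+1}=\mathsf{succ}\,\underline n$. The relation $\tilde\leadsto$ is the inductive family generated by: - $\mathsf{pred}\,\underline0\tilde\leadsto\underline0$; - $\mathsf{pred}\,\underline{n+1}\tilde\leadsto\underline n$; - $\mathsf{ifz}\,s\,t\,\underline0\tilde\leadsto s$; - $\mathsf{ifz}\,s\,t\,\underline{n+1}\tilde\leadsto t$; - $\mathsf kst\tilde\leadsto s$; - $\mathsf sfgt\tilde\leadsto ft(gt)$; - $\mathsf{fix}\,f\tilde\leadsto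 f(\mathsf{fix}\,f)$; - if $f\tilde\leadsto g$ then $ft\tilde\leadsto gt$; - congruence under $\mathsf{succ}$ and $\mathsf{pred}$; - congruence in the last argument of $\mathsf{ifz}$. Set $s\leadsto t:=\|s\tilde\leadsto t\|$. The relation $\leadsto^*$ is $\|\cdot\|$ applied to the inductive reflexive-transitive closure (constructors: extend, refl, trans) of $\leadsto$. Semantics. The lifting is $\mathcal L(X)=\sum_{P:\Omega}(P\to X)$ with $\mathrm{isdefined}=\mathsf{pr}_1$ and $\mathrm{value}(P,\varphi)(p)=\varphi(p)$. We write $\eta(x)=(\mathbf 1,\lambda t.x)$ and $\bot=(\mathbf 0,!)$. The order is $l\sqsubseteq m:=(\mathrm{isdefined}(l)\to l=m)$, and directed suprema (indexed by types in $\mathcal U_0$) are $(\|\sum_i\mathrm{isdefined}(u_i)\|,\phi)$. $[\![\iota]\!]=\mathcal L(\mathbb N)$, and $[\![\sigma\Rightarrow\tau]\!]$ is the dcpo with $\bot$ of continuous maps with the pointwise order. Interpretation of terms: - $[\![\mathsf{zero}]\!]=\eta(0)$; - $[\![\mathsf{succ}]\!]=\mathcal L(\mathrm{succ})$ and $[\![\mathsf{pred}]\!]=\mathcal L(\mathrm{pred})$, where $\mathcal L(f)(P,\varphi)=(P,f\circ\varphi)$; - $[\![\mathsf{ifz}]\!]=\lambda x,y.(\chi_{x,y})^\#$, where $\chi_{x,y}(0)=x$, $\chi_{x,y}(n+1)=y$, and $g^\#(P,\varphi)=(\sum_{p:P}\mathrm{isdefined}(g(\varphi p)),(p,d)\mapsto\mathrm{value}(g(\varphi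 p))(d))$; - $[\![\mathsf k]\!]=\lambda x,y.x$; - $[\![\mathsf s]\!]=\lambda f,g,x.f(x)(g(x))$; - $[\![\mathsf{fix}]\!](f)=\bigsqcup_n f^n(\bot)$; - $[\![st]\!]=[\![s]\!]([\![t]\!])$. The logical relation is defined by induction on types: - $t\,R_\iota\,d:=\prod_{p:\mathrm{isdefined}(d)}t\leadsto^*\underline{\mathrm{value}(d)(p)}$; - $s\,R_{\tau\Rightarrow\rho}\,f:=\prod_{t:\tau}\prod_{d:[\![\tau]\!]}(t\,R_\tau\,d\to st\,R_\rho\,f(d))$. -}

{-# OPTIONS --without-K #-}
module Defs where

open import Level using (Level; Lift; lift; Setω) renaming (suc to lsuc; zero to lzero)
open import Data.Nat using (ℕ; zero; suc; pred; _≤_; z≤n; s≤s) renaming (_⊔_ to max)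
open import Data.Nat.Properties using (≡-irrelevant; m≤m⊔n; m≤n⊔m)
open import Data.Unit using (⊤; tt)
open import Data.Empty using (⊥)
open import Data.Product using (Σ; _×_; _,_; proj₁; proj₂)
open import Function using (_∘_)
open import Relation.Binary.PropositionalEquality
  using (_≡_; refl; sym; trans; cong; subst)
open import Relation.Binary.PropositionalEquality.Properties using (trans-symˡ)
open import Axiom.Extensionality.Propositional using (Extensionality)

isProp : ∀ {ℓ} → Set ℓ → Set ℓ
isProp A = (x y : A) → x ≡ y

record PropTrunc : Setω where
  field
    ∥_∥    : ∀ {ℓ} → Set ℓ → Set ℓ
    ∣_∣    : ∀ {ℓ} {A : Set ℓ} → A → ∥ A ∥
    squash : ∀ {ℓ} {A : Set ℓ} → isProp ∥ A ∥
    ∥∥-rec : ∀ {ℓ ℓ'} {A : Set ℓ} {B : Set ℓ'} → isProp B → (A → B) → ∥ A ∥ → B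

FunExt : Setω
FunExt = ∀ {a b} → Extensionality a b

PropExt : Set₁
PropExt = {P Q : Set} → isProp P → isProp Q → (P → Q) → (Q → P) → P ≡ Q

infixr 30 _⇒_
data Ty : Set where
  ι   : Ty
  _⇒_ : Ty → Ty → Ty

infixl 20 _·_
data Term : Ty → Set where
  Zero : Term ι
  Succ : Term (ι ⇒ ι)
  Pred : Term (ι ⇒ ι)
  Ifz  : Term (ι ⇒ ι ⇒ ι ⇒ ι)
  K    : {σ τ : Ty} → Term (σ ⇒ τ ⇒ σ)
  S    : {σ τ ρ : Ty} → Term ((σ ⇒ τ ⇒ ρ) ⇒ (σ ⇒ τ) ⇒ σ ⇒ ρ)
  Fix  : {σ : Ty} → Term ((σ ⇒ σ) ⇒ σ)
  _·_  : {σ τ : Ty} → Term (σ ⇒ τ) → Term σ → Term τ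

numeral : ℕ → Term ι
numeral zero    = Zero
numeral (suc n) = Succ · numeral n

infix 4 _~̃>_
data _~̃>_ : {σ : Ty} → Term σ → Term σ → Set where
  pred-zero : Pred · numeral 0 ~̃> numeral 0
  pred-suc  : (n : ℕ) → Pred · numeral (suc n) ~̃> numeral n
  ifz-zero  : (s t : Term ι) → Ifz · s · t · numeral 0 ~̃> s
  ifz-suc   : (s t : Term ι) (n : ℕ) → Ifz · s · t · numeral (suc n) ~̃> t
  k-red     : {σ τ : Ty} (s : Term σ) (t : Term τ) → K · s · t ~̃> s
  s-red     : {σ τ ρ : Ty} (f : Term (σ ⇒ τ ⇒ ρ)) (g : Term (σ ⇒ τ)) (t : Term σ)
            → S · f · g · t ~̃> f · t · (g · t)
  fix-red   : {σ : Ty} (f : Term (σ ⇒ σ)) → Fix · f ~̃> f · (Fix · f)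
  app-cong  : {σ τ : Ty} {f g : Term (σ ⇒ τ)} (t : Term σ) → f ~̃> g → f · t ~̃> g · t
  succ-cong : {s t : Term ι} → s ~̃> t → Succ · s ~̃> Succ · t
  pred-cong : {s t : Term ι} → s ~̃> t → Pred · s ~̃> Pred · t
  ifz-cong  : (s t : Term ι) {r r' : Term ι} → r ~̃> r' → Ifz · s · t · r ~̃> Ifz · s · t · r'

prop-set : ∀ {ℓ} {A : Set ℓ} → isProp A → {x y : A} (p q : x ≡ y) → p ≡ q
prop-set {A = A} h {x} p q = trans (lem p) (sym (lem q))
  where
  lem : {y : A} (p : x ≡ y) → p ≡ trans (sym (h x x)) (h x y)
  lem refl = sym (trans-symˡ (h x x))

Σ-prop : ∀ {a b} {A : Set a} {B : A → Set b} → isProp A → (∀ x → isProp (B x))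
       → isProp (Σ A B)
Σ-prop {B = B} hA hB (a , b) (a' , b') = go (hA a a') b'
  where
  go : {a' : _} → a ≡ a' → (b' : B a') → (a , b) ≡ (a' , b')
  go refl b' = cong (a ,_) (hB a b b')

Σ-prop-≡ : ∀ {a b} {A : Set a} {B : A → Set b} → (∀ x → isProp (B x))
         → {x y : Σ A B} → proj₁ x ≡ proj₁ y → x ≡ y
Σ-prop-≡ hB {a , b} {.a , c} refl = cong (a ,_) (hB a b c)

module PCF (pt : PropTrunc) (fe : FunExt) (pe : PropExt) where
  open PropTrunc pt

  ∥∥-map : ∀ {a b} {A : Set a} {B : Set b} → (A → B) → ∥ A ∥ → ∥ B ∥
  ∥∥-map f = ∥∥-rec squash (λ a → ∣ f a ∣)

  infix 4 _~>_ _~>ᶜ_ _~>*_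
  _~>_ : {σ : Ty} → Term σ → Term σ → Set
  s ~> t = ∥ s ~̃> t ∥

  data _~>ᶜ_ {σ : Ty} : Term σ → Term σ → Set where
    extend : {s t : Term σ} → s ~> t → s ~>ᶜ t
    rfl    : {s : Term σ} → s ~>ᶜ s
    trns   : {s t u : Term σ} → s ~>ᶜ t → t ~>ᶜ u → s ~>ᶜ u

  _~>*_ : {σ : Ty} → Term σ → Term σ → Set
  s ~>* t = ∥ s ~>ᶜ t ∥

  isProp-isProp : ∀ {ℓ} {A : Set ℓ} → isProp (isProp A)
  isProp-isProp h h' = fe (λ x → fe (λ y → prop-set h (h x y) (h' x y)))

  Ω : Set₁
  Ω = Σ Set isProp

  𝓛 : Set → Set₁
  𝓛 X = Σ Ω (λ P → proj₁ P → X)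

  isdefined : {X : Set} → 𝓛 X → Set
  isdefined l = proj₁ (proj₁ l)

  isdefined-prop : {X : Set} (l : 𝓛 X) → isProp (isdefined l)
  isdefined-prop l = proj₂ (proj₁ l)

  value : {X : Set} (l : 𝓛 X) → isdefined l → X
  value l = proj₂ l

  η : {X : Set} → X → 𝓛 X
  η x = (⊤ , (λ { tt tt → refl })) , (λ _ → x)

  𝓛-bot : {X : Set} → 𝓛 X
  𝓛-bot = (⊥ , (λ ())) , (λ ())

  𝓛-map : {X Y : Set} → (X → Y) → 𝓛 X → 𝓛 Y
  𝓛-map f (P , φ) = P , (f ∘ φ)

  𝓛-ext : {X : Set} (l m : 𝓛 X) → (isdefined l → isdefined m) → (isdefined m → isdefined l)
        → (∀ p q → value l p ≡ value m q) → l ≡ m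
  𝓛-ext ((P , hP) , φ) ((Q , hQ) , ψ) f g v = go (pe hP hQ f g) hQ ψ v
    where
    go : {Q : Set} → P ≡ Q → (hQ : isProp Q) (ψ : Q → _)
       → (∀ (p : P) q → φ p ≡ ψ q) → ((P , hP) , φ) ≡ ((Q , hQ) , ψ)
    go refl hQ ψ v with isProp-isProp hP hQ
    ... | refl = cong (λ χ → ((P , hP) , χ)) (fe (λ p → v p p))

  value-cong : {X : Set} {l m : 𝓛 X} → l ≡ m → (p : isdefined l) (q : isdefined m)
             → value l p ≡ value m q
  value-cong {l = l} refl p q = cong (value l) (isdefined-prop l p q)

  𝓛ℕ-stable : (l m : 𝓛 ℕ) → isdefined l → ∥ l ≡ m ∥ → l ≡ m
  𝓛ℕ-stable l m p t =
    𝓛-ext l m (λ _ → ∥∥-rec (isdefined-prop m) (λ e → subst isdefined e p) t)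
              (λ _ → p)
              (λ p' q → ∥∥-rec ≡-irrelevant (λ e → value-cong e p' q) t)

  _⊑𝓛_ : {X : Set} → 𝓛 X → 𝓛 X → Set₁
  l ⊑𝓛 m = isdefined l → l ≡ m

  ⊑-via-≡ : {X : Set} {l l' u : 𝓛 X} → l ≡ l' → l' ⊑𝓛 u → l ⊑𝓛 u
  ⊑-via-≡ e a d = trans e (a (subst isdefined e d))

  Directed : {C : Set₁} (_⊑_ : C → C → Set₁) {I : Set} → (I → C) → Set₁
  Directed _⊑_ {I} α = ∥ I ∥ × ((i j : I) → ∥ Σ I (λ k → (α i ⊑ α k) × (α j ⊑ α k)) ∥)

  record DCPO : Set₂ where
    field
      C         : Set₁
      _⊑_       : C → C → Set₁
      ⊑-refl    : {x : C} → x ⊑ x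
      ⊑-trans   : {x y z : C} → x ⊑ y → y ⊑ z → x ⊑ z
      ⊑-stable  : {x y : C} → ∥ x ⊑ y ∥ → x ⊑ y
      bot       : C
      bot-least : {x : C} → bot ⊑ x
      ⨆         : {I : Set} (α : I → C) → Directed _⊑_ α → C
      ⨆-ub      : {I : Set} {α : I → C} (δ : Directed _⊑_ α) (i : I) → α i ⊑ ⨆ α δ
      ⨆-least   : {I : Set} {α : I → C} (δ : Directed _⊑_ α) {u : C}
                → ((i : I) → α i ⊑ u) → ⨆ α δ ⊑ u
  open DCPO public

  isSup : (D : DCPO) {I : Set} → C D → (I → C D) → Set₁
  isSup D x α = ((i : _) → _⊑_ D (α i) x) × ((u : C D) → ((i : _) → _⊑_ D (α i) u) → _⊑_ D x u)

  Monotone : (D E : DCPO) → (C D → C E) → Set₁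
  Monotone D E f = {x y : C D} → _⊑_ D x y → _⊑_ E (f x) (f y)

  Continuous : (D E : DCPO) → (C D → C E) → Set₁
  Continuous D E f = Monotone D E f
                   × ({I : Set} (α : I → C D) (δ : Directed (_⊑_ D) α)
                      → isSup E (f (⨆ D α δ)) (f ∘ α))

  module _ {I : Set} (α : I → 𝓛 ℕ) (δ : Directed _⊑𝓛_ α) where
    private
      V : Set
      V = Σ ℕ (λ n → ∥ Σ I (λ i → Σ (isdefined (α i)) (λ p → value (α i) p ≡ n)) ∥)

      V-prop : isProp V
      V-prop x y = Σ-prop-≡ (λ _ → squash) (eq x y)
        where
        eq : (x y : V) → proj₁ x ≡ proj₁ y
        eq (n , a) (m , b) =
          ∥∥-rec ≡-irrelevant (λ { (i , p , e) →
          ∥∥-rec ≡-irrelevant (λ { (j , q , e') →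
          ∥∥-rec ≡-irrelevant (λ { (k , ik , jk) →
            let p' = subst isdefined (ik p) p in
            trans (sym e) (trans (value-cong (ik p) p p')
                  (trans (sym (value-cong (jk q) q p')) e')) }) (proj₂ δ i j) }) b }) a

      pick : ∥ Σ I (λ i → isdefined (α i)) ∥ → V
      pick = ∥∥-rec V-prop (λ { (i , p) → value (α i) p , ∣ i , p , refl ∣ })

    𝓛-sup : 𝓛 ℕ
    𝓛-sup = (∥ Σ I (λ i → isdefined (α i)) ∥ , squash) , (λ t → proj₁ (pick t))

    𝓛-sup-ub : (i : I) → α i ⊑𝓛 𝓛-sup
    𝓛-sup-ub i p = 𝓛-ext (α i) 𝓛-sup (λ _ → ∣ i , p ∣) (λ _ → p)
      (λ p' t → cong proj₁ (V-prop (value (α i) p' , ∣ i , p' , refl ∣) (pick t)))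

    𝓛-sup-least : {u : 𝓛 ℕ} → ((i : I) → α i ⊑𝓛 u) → 𝓛-sup ⊑𝓛 u
    𝓛-sup-least {u} h t = 𝓛ℕ-stable 𝓛-sup u t
      (∥∥-map (λ { (i , p) → trans (sym (𝓛-sup-ub i p)) (h i p) }) t)

  𝓛ℕ-DCPO : DCPO
  𝓛ℕ-DCPO = record
    { C = 𝓛 ℕ
    ; _⊑_ = _⊑𝓛_
    ; ⊑-refl = λ _ → refl
    ; ⊑-trans = λ a b p → trans (a p) (b (subst isdefined (a p) p))
    ; ⊑-stable = λ {x} {y} t p → 𝓛ℕ-stable x y p (∥∥-map (λ a → a p) t)
    ; bot = 𝓛-bot
    ; bot-least = λ ()
    ; ⨆ = 𝓛-sup
    ; ⨆-ub = λ {_} {α} δ i → 𝓛-sup-ub α δ i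
    ; ⨆-least = λ {_} {α} δ h → 𝓛-sup-least α δ h
    }

  module Exp (D E : DCPO) where
    Cexp : Set₁
    Cexp = Σ (C D → C E) (Continuous D E)

    _⊑e_ : Cexp → Cexp → Set₁
    f ⊑e g = (x : C D) → _⊑_ E (proj₁ f x) (proj₁ g x)

    dir-app : {I : Set} {α : I → Cexp} → Directed _⊑e_ α → (x : C D)
            → Directed (_⊑_ E) (λ i → proj₁ (α i) x)
    dir-app δ x = proj₁ δ , (λ i j → ∥∥-map (λ { (k , a , b) → k , a x , b x }) (proj₂ δ i j))

    sup-fun : {I : Set} (α : I → Cexp) (δ : Directed _⊑e_ α) → C D → C E
    sup-fun α δ x = ⨆ E (λ i → proj₁ (α i) x) (dir-app {α = α} δ x)

    sup-cont : {I : Set} (α : I → Cexp) (δ : Directed _⊑e_ α) → Continuous D E (sup-fun α δ)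
    sup-cont α δ = mono , cont
      where
      mono : Monotone D E (sup-fun α δ)
      mono x⊑y = ⨆-least E _ (λ i → ⊑-trans E (proj₁ (proj₂ (α i)) x⊑y) (⨆-ub E _ i))
      cont : {J : Set} (β : J → C D) (ε : Directed (_⊑_ D) β)
           → isSup E (sup-fun α δ (⨆ D β ε)) (sup-fun α δ ∘ β)
      cont β ε = (λ j → mono (⨆-ub D ε j))
               , (λ u h → ⨆-least E _ (λ i → proj₂ (proj₂ (proj₂ (α i)) β ε) u
                                      (λ j → ⊑-trans E (⨆-ub E _ i) (h j))))

    DCPO⇒ : DCPO
    DCPO⇒ = record
      { C = Cexp
      ; _⊑_ = _⊑e_
      ; ⊑-refl = λ x → ⊑-refl E
      ; ⊑-trans = λ a b x → ⊑-trans E (a x) (b x)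
      ; ⊑-stable = λ t x → ⊑-stable E (∥∥-map (λ a → a x) t)
      ; bot = (λ _ → bot E) , (λ _ → ⊑-refl E) , (λ α δ → (λ i → ⊑-refl E) , (λ u _ → bot-least E))
      ; bot-least = λ x → bot-least E
      ; ⨆ = λ α δ → sup-fun α δ , sup-cont α δ
      ; ⨆-ub = λ {_} {α} δ i x → ⨆-ub E (dir-app {α = α} δ x) i
      ; ⨆-least = λ {_} {α} δ h x → ⨆-least E (dir-app {α = α} δ x) (λ i → h i x)
      }

  _⇛_ : DCPO → DCPO → DCPO
  D ⇛ E = Exp.DCPO⇒ D E

  ⟦_⟧ᵀ : Ty → DCPO
  ⟦ ι ⟧ᵀ     = 𝓛ℕ-DCPO
  ⟦ σ ⇒ τ ⟧ᵀ = ⟦ σ ⟧ᵀ ⇛ ⟦ τ ⟧ᵀ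

  app : {D E : DCPO} → C (D ⇛ E) → C D → C E
  app f = proj₁ f

  mono-of : {D E : DCPO} (f : C (D ⇛ E)) → Monotone D E (app {D} {E} f)
  mono-of f = proj₁ (proj₂ f)

  sup-of : {D E : DCPO} (f : C (D ⇛ E)) {I : Set} (α : I → C D) (δ : Directed (_⊑_ D) α)
         → isSup E (app {D} {E} f (⨆ D α δ)) (app {D} {E} f ∘ α)
  sup-of f = proj₂ (proj₂ f)

  mono-dir : (D E : DCPO) (f : C D → C E) → Monotone D E f → {I : Set} {α : I → C D}
           → Directed (_⊑_ D) α → Directed (_⊑_ E) (f ∘ α)
  mono-dir D E f m δ = proj₁ δ , (λ i j → ∥∥-map (λ { (k , a , b) → k , m a , m b }) (proj₂ δ i j))

  const-isSup : (D : DCPO) (x : C D) {I : Set} → ∥ I ∥ → isSup D x (λ (_ : I) → x)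
  const-isSup D x inh = (λ _ → ⊑-refl D) , (λ u h → ⊑-stable D (∥∥-map h inh))

  const-cont : (D E : DCPO) (e : C E) → Continuous D E (λ _ → e)
  const-cont D E e = (λ _ → ⊑-refl E) , (λ α δ → const-isSup E e (proj₁ δ))

  strict-cont : (g : 𝓛 ℕ → 𝓛 ℕ) → Monotone 𝓛ℕ-DCPO 𝓛ℕ-DCPO g
              → ((l : 𝓛 ℕ) → isdefined (g l) → isdefined l) → Continuous 𝓛ℕ-DCPO 𝓛ℕ-DCPO g
  strict-cont g m s = m , λ α δ →
      (λ i → m (𝓛-sup-ub α δ i))
    , (λ u h d → 𝓛ℕ-stable _ u d
         (∥∥-map (λ { (i , q) → ⊑-via-≡ (cong g (sym (𝓛-sup-ub α δ i q))) (h i) d })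
                 (s _ d)))

  𝓛-map-cont : (f : ℕ → ℕ) → C (⟦ ι ⟧ᵀ ⇛ ⟦ ι ⟧ᵀ)
  𝓛-map-cont f = 𝓛-map f , strict-cont (𝓛-map f) (λ a p → cong (𝓛-map f) (a p)) (λ l d → d)

  _♯ : (ℕ → 𝓛 ℕ) → 𝓛 ℕ → 𝓛 ℕ
  (g ♯) ((P , hP) , φ) =
    (Σ P (λ p → isdefined (g (φ p))) , Σ-prop hP (λ p → isdefined-prop (g (φ p))))
    , (λ { (p , d) → value (g (φ p)) d })

  ♯-at : (g : ℕ → 𝓛 ℕ) (l : 𝓛 ℕ) (p : isdefined l) → (g ♯) l ≡ g (value l p)
  ♯-at g l p = 𝓛-ext ((g ♯) l) (g (value l p))
    (λ { (p' , d) → subst (λ q → isdefined (g (value l q))) (isdefined-prop l p' p) d })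
    (λ d → p , d)
    (λ { (p' , d) q → value-cong (cong (g ∘ value l) (isdefined-prop l p' p)) d q })

  ♯-mono : (g : ℕ → 𝓛 ℕ) → Monotone 𝓛ℕ-DCPO 𝓛ℕ-DCPO (g ♯)
  ♯-mono g a (p , d) = cong (g ♯) (a p)

  ♯-mono-g : (g g' : ℕ → 𝓛 ℕ) → ((n : ℕ) → g n ⊑𝓛 g' n) → (z : 𝓛 ℕ) → (g ♯) z ⊑𝓛 (g' ♯) z
  ♯-mono-g g g' gg z (p , d) =
    trans (♯-at g z p) (trans (gg (value z p) d) (sym (♯-at g' z p)))

  ♯-pw-sup : {J : Set} (G : J → ℕ → 𝓛 ℕ) (G∞ : ℕ → 𝓛 ℕ)
           → ((n : ℕ) → isSup 𝓛ℕ-DCPO (G∞ n) (λ j → G j n))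
           → (z : 𝓛 ℕ) → isSup 𝓛ℕ-DCPO ((G∞ ♯) z) (λ j → (G j ♯) z)
  ♯-pw-sup G G∞ hs z =
      (λ j → ♯-mono-g (G j) G∞ (λ n → proj₁ (hs n) j) z)
    , (λ u h → λ { (p , d) → trans (♯-at G∞ z p)
          (proj₂ (hs (value z p)) u (λ j → ⊑-via-≡ (sym (♯-at (G j) z p)) (h j)) d) })

  χ : 𝓛 ℕ → 𝓛 ℕ → ℕ → 𝓛 ℕ
  χ x y zero    = x
  χ x y (suc n) = y

  ifz₁ : 𝓛 ℕ → 𝓛 ℕ → C (⟦ ι ⟧ᵀ ⇛ ⟦ ι ⟧ᵀ)
  ifz₁ x y = (χ x y ♯) , strict-cont (χ x y ♯) (♯-mono (χ x y)) (λ l d → proj₁ d)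

  ifz₂ : 𝓛 ℕ → C (⟦ ι ⟧ᵀ ⇛ ⟦ ι ⇒ ι ⟧ᵀ)
  ifz₂ x = ifz₁ x , mono , cont
    where
    mono : Monotone 𝓛ℕ-DCPO (⟦ ι ⟧ᵀ ⇛ ⟦ ι ⟧ᵀ) (ifz₁ x)
    mono {y} {y'} a = ♯-mono-g (χ x y) (χ x y') (λ { zero → λ _ → refl ; (suc n) → a })
    cont : {J : Set} (β : J → 𝓛 ℕ) (ε : Directed _⊑𝓛_ β)
         → isSup (⟦ ι ⟧ᵀ ⇛ ⟦ ι ⟧ᵀ) (ifz₁ x (𝓛-sup β ε)) (ifz₁ x ∘ β)
    cont β ε = (λ j z → proj₁ (pw z) j) , (λ u h z → proj₂ (pw z) (proj₁ u z) (λ j → h j z))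
      where
      hs : (n : ℕ) → isSup 𝓛ℕ-DCPO (χ x (𝓛-sup β ε) n) (λ j → χ x (β j) n)
      hs zero    = const-isSup 𝓛ℕ-DCPO x (proj₁ ε)
      hs (suc n) = 𝓛-sup-ub β ε , (λ u h → 𝓛-sup-least β ε h)
      pw = ♯-pw-sup (λ j → χ x (β j)) (χ x (𝓛-sup β ε)) hs

  ifz₃ : C ⟦ ι ⇒ ι ⇒ ι ⇒ ι ⟧ᵀ
  ifz₃ = ifz₂ , mono , cont
    where
    mono : Monotone 𝓛ℕ-DCPO ⟦ ι ⇒ ι ⇒ ι ⟧ᵀ ifz₂
    mono {x} {x'} a y = ♯-mono-g (χ x y) (χ x' y) (λ { zero → a ; (suc n) → λ _ → refl })
    cont : {J : Set} (α : J → 𝓛 ℕ) (δ : Directed _⊑𝓛_ α)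
         → isSup ⟦ ι ⇒ ι ⇒ ι ⟧ᵀ (ifz₂ (𝓛-sup α δ)) (ifz₂ ∘ α)
    cont α δ = (λ j y z → proj₁ (pw y z) j)
             , (λ u h y z → proj₂ (pw y z) (app {⟦ ι ⟧ᵀ} {⟦ ι ⟧ᵀ} (app {⟦ ι ⟧ᵀ} {⟦ ι ⇒ ι ⟧ᵀ} u y) z) (λ j → h j y z))
      where
      hs : (y : 𝓛 ℕ) (n : ℕ) → isSup 𝓛ℕ-DCPO (χ (𝓛-sup α δ) y n) (λ j → χ (α j) y n)
      hs y zero    = 𝓛-sup-ub α δ , (λ u h → 𝓛-sup-least α δ h)
      hs y (suc n) = const-isSup 𝓛ℕ-DCPO y (proj₁ δ)
      pw : (y z : 𝓛 ℕ) → _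
      pw y = ♯-pw-sup (λ j → χ (α j) y) (χ (𝓛-sup α δ) y) (hs y)

  k-interp : (D E : DCPO) → C (D ⇛ (E ⇛ D))
  k-interp D E = (λ x → (λ _ → x) , const-cont E D x)
               , (λ a y → a)
               , (λ α δ → (λ i y → ⨆-ub D δ i) , (λ u h y → ⨆-least D δ (λ i → h i y)))

  module SInterp (D E F : DCPO) where
    private
      aF = app {D} {E ⇛ F}
      aEF = app {E} {F}
      aDE = app {D} {E}
      aDF = app {D} {F}
      mF = mono-of {D} {E ⇛ F}
      mEF = mono-of {E} {F}
      mDE = mono-of {D} {E}
      sF = sup-of {D} {E ⇛ F}
      sEF = sup-of {E} {F}
      sDE = sup-of {D} {E}
    s₁ : C (D ⇛ (E ⇛ F)) → C (D ⇛ E) → C D → C F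
    s₁ f g x = aEF (aF f x) (aDE g x)

    s₁-cont : (f : C (D ⇛ (E ⇛ F))) (g : C (D ⇛ E)) → Continuous D F (s₁ f g)
    s₁-cont f g = mono , cont
      where
      mono : Monotone D F (s₁ f g)
      mono {x} {x'} a = ⊑-trans F (mF f a (aDE g x)) (mEF (aF f x') (mDE g a))
      cont : {I : Set} (α : I → C D) (δ : Directed (_⊑_ D) α)
           → isSup F (s₁ f g (⨆ D α δ)) (s₁ f g ∘ α)
      cont α δ = (λ i → mono (⨆-ub D δ i)) , least
        where
        a = ⨆ D α δ
        fδ = mono-dir D (E ⇛ F) (aF f) (mF f) δ
        gδ = mono-dir D E (aDE g) (mDE g) δ
        step1 : _⊑_ (E ⇛ F) (aF f a) (⨆ (E ⇛ F) (aF f ∘ α) fδ)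
        step1 = proj₂ (sF f α δ) (⨆ (E ⇛ F) (aF f ∘ α) fδ) (⨆-ub (E ⇛ F) {α = aF f ∘ α} fδ)
        step2 : _⊑_ E (aDE g a) (⨆ E (aDE g ∘ α) gδ)
        step2 = proj₂ (sDE g α δ) _ (⨆-ub E gδ)
        least : (u : C F) → ((i : _) → _⊑_ F (s₁ f g (α i)) u) → _⊑_ F (s₁ f g a) u
        least u h = ⊑-trans F (step1 (aDE g a))
          (⨆-least F _ (λ i → ⊑-trans F (mEF (aF f (α i)) step2)
            (proj₂ (sEF (aF f (α i)) (aDE g ∘ α) gδ) u
              (λ j → ⊑-stable F (∥∥-map (λ { (k , ik , jk) →
                 ⊑-trans F (mF f ik (aDE g (α j)))
                   (⊑-trans F (mEF (aF f (α k)) (mDE g jk)) (h k)) })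
                 (proj₂ δ i j))))))

    s₂ : C (D ⇛ (E ⇛ F)) → C (D ⇛ E) → C (D ⇛ F)
    s₂ f g = s₁ f g , s₁-cont f g

    s₂-cont : (f : C (D ⇛ (E ⇛ F))) → Continuous (D ⇛ E) (D ⇛ F) (s₂ f)
    s₂-cont f = (λ a x → mEF (aF f x) (a x))
              , (λ β ε → (λ j x → mEF (aF f x) (⨆-ub (D ⇛ E) {α = β} ε j x))
                       , (λ u h x → proj₂ (sEF (aF f x) (λ j → aDE (β j) x)
                                             (Exp.dir-app D E {α = β} ε x))
                                       (aDF u x) (λ j → h j x)))

    s₃ : C (D ⇛ (E ⇛ F)) → C ((D ⇛ E) ⇛ (D ⇛ F))
    s₃ f = s₂ f , s₂-cont f

    s-interp : C ((D ⇛ (E ⇛ F)) ⇛ ((D ⇛ E) ⇛ (D ⇛ F)))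
    s-interp = s₃
             , (λ a g x → a x (aDE g x))
             , (λ γ ε → (λ j g x → ⨆-ub F _ j)
                      , (λ u h g x → ⨆-least F _ (λ j → h j g x)))

  module FixInterp (D : DCPO) where
    iter : C (D ⇛ D) → ℕ → C D
    iter f zero    = bot D
    iter f (suc n) = app {D} {D} f (iter f n)

    iter-≤ : (f : C (D ⇛ D)) {m n : ℕ} → m ≤ n → _⊑_ D (iter f m) (iter f n)
    iter-≤ f z≤n     = bot-least D
    iter-≤ f (s≤s p) = mono-of {D} {D} f (iter-≤ f p)

    iter-dir : (f : C (D ⇛ D)) → Directed (_⊑_ D) (iter f)
    iter-dir f = ∣ 0 ∣ , (λ i j → ∣ max i j , iter-≤ f (m≤m⊔n i j) , iter-≤ f (m≤n⊔m i j) ∣)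

    fix : C (D ⇛ D) → C D
    fix f = ⨆ D (iter f) (iter-dir f)

    iter-mono-f : {f g : C (D ⇛ D)} → _⊑_ (D ⇛ D) f g → (n : ℕ) → _⊑_ D (iter f n) (iter g n)
    iter-mono-f fg zero    = ⊑-refl D
    iter-mono-f {f} {g} fg (suc n) = ⊑-trans D (fg (iter f n)) (mono-of {D} {D} g (iter-mono-f fg n))

    fix-mono : Monotone (D ⇛ D) D fix
    fix-mono fg = ⨆-least D _ (λ n → ⊑-trans D (iter-mono-f fg n) (⨆-ub D _ n))

    fix-sup : {J : Set} (γ : J → C (D ⇛ D)) (ε : Directed (_⊑_ (D ⇛ D)) γ)
            → isSup D (fix (⨆ (D ⇛ D) γ ε)) (fix ∘ γ)
    fix-sup {J} γ ε = (λ j → fix-mono (⨆-ub (D ⇛ D) {α = γ} ε j)) , least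
      where
      Γ = ⨆ (D ⇛ D) γ ε
      dirn : (n : ℕ) → Directed (_⊑_ D) (λ j → iter (γ j) n)
      dirn n = mono-dir (D ⇛ D) D (λ f → iter f n) (λ fg → iter-mono-f fg n) ε
      claim : (n : ℕ) → _⊑_ D (iter Γ n) (⨆ D (λ j → iter (γ j) n) (dirn n))
      claim zero    = bot-least D
      claim (suc n) = ⨆-least D _ (λ j → ⊑-trans D (mono-of {D} {D} (γ j) (claim n))
        (proj₂ (sup-of {D} {D} (γ j) (λ k → iter (γ k) n) (dirn n)) _
          (λ k → ⊑-stable D (∥∥-map (λ { (m , jm , km) →
             ⊑-trans D (jm (iter (γ k) n))
               (⊑-trans D (mono-of {D} {D} (γ m) (iter-mono-f km n)) (⨆-ub D (dirn (suc n)) m)) })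
             (proj₂ ε j k)))))
      least : (u : C D) → ((j : J) → _⊑_ D (fix (γ j)) u) → _⊑_ D (fix Γ) u
      least u h = ⨆-least D _ (λ n → ⊑-trans D (claim n)
        (⨆-least D _ (λ j → ⊑-trans D (⨆-ub D (iter-dir (γ j)) n) (h j))))

    fix-interp : C ((D ⇛ D) ⇛ D)
    fix-interp = fix , fix-mono , fix-sup

  ⟦_⟧ : {σ : Ty} → Term σ → C ⟦ σ ⟧ᵀ
  ⟦ Zero ⟧                = η 0
  ⟦ Succ ⟧                = 𝓛-map-cont suc
  ⟦ Pred ⟧                = 𝓛-map-cont pred
  ⟦ Ifz ⟧                 = ifz₃
  ⟦ K {σ} {τ} ⟧           = k-interp ⟦ σ ⟧ᵀ ⟦ τ ⟧ᵀ
  ⟦ S {σ} {τ} {ρ} ⟧       = SInterp.s-interp ⟦ σ ⟧ᵀ ⟦ τ ⟧ᵀ ⟦ ρ ⟧ᵀ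
  ⟦ Fix {σ} ⟧             = FixInterp.fix-interp ⟦ σ ⟧ᵀ
  ⟦ _·_ {σ} {τ} s t ⟧    = app {⟦ σ ⟧ᵀ} {⟦ τ ⟧ᵀ} ⟦ s ⟧ ⟦ t ⟧

  R : (σ : Ty) → Term σ → C ⟦ σ ⟧ᵀ → Set₁
  R ι       t d = Lift (lsuc lzero) ((p : isdefined d) → t ~>* numeral (value d p))
  R (τ ⇒ ρ) s f = (t : Term τ) (d : C ⟦ τ ⟧ᵀ) → R τ t d → R ρ (s · t) (app {⟦ τ ⟧ᵀ} {⟦ ρ ⟧ᵀ} f d)

-- For fix, the relation at each type is closed under head expansion, contains
-- ⊥ and is closed under directed suprema; hence every approximant fⁿ(⊥) is
-- related to fix f, and so is their supremum [[fix]](f).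
module Submission where

open import Defs
open import Level using (lift; lower)
open import Data.Nat using (ℕ; zero; suc; pred)
open import Data.Product using (_,_; proj₁)
open import Relation.Binary.PropositionalEquality using (subst)

module LogicalRelation (pt : PropTrunc) (fe : FunExt) (pe : PropExt) where
  open PropTrunc pt
  open PCF pt fe pe

  ~̃>⇒~>* : {σ : Ty} {s t : Term σ} → s ~̃> t → s ~>* t
  ~̃>⇒~>* r = ∣ extend ∣ r ∣ ∣

  infixr 5 _⨾_
  _⨾_ : {σ : Ty} {s t u : Term σ} → s ~>* t → t ~>* u → s ~>* u
  a ⨾ b = ∥∥-rec squash (λ x → ∥∥-map (trns x) b) a

  module _ {σ τ : Ty} (F : Term σ → Term τ) (F-step : ∀ {a b} → a ~̃> b → F a ~̃> F b) where

    ~>ᶜ-cong : ∀ {a b} → a ~>ᶜ b → F a ~>ᶜ F b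
    ~>ᶜ-cong (extend r) = extend (∥∥-map F-step r)
    ~>ᶜ-cong rfl        = rfl
    ~>ᶜ-cong (trns r q) = trns (~>ᶜ-cong r) (~>ᶜ-cong q)

    ~>*-cong : ∀ {a b} → a ~>* b → F a ~>* F b
    ~>*-cong = ∥∥-map ~>ᶜ-cong

  R-expand : (σ : Ty) {s s' : Term σ} {d : C ⟦ σ ⟧ᵀ} → s ~>* s' → R σ s' d → R σ s d
  R-expand ι       r rel         = lift (λ p → r ⨾ lower rel p)
  R-expand (τ ⇒ ρ) r rel t e rte =
    R-expand ρ (~>*-cong (_· t) (app-cong t) r) (rel t e rte)

  R-⊥ : (σ : Ty) (t : Term σ) → R σ t (bot ⟦ σ ⟧ᵀ)
  R-⊥ ι       t         = lift (λ ())
  R-⊥ (τ ⇒ ρ) s t e rte = R-⊥ ρ (s · t)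

  R-⨆ : (σ : Ty) {I : Set} (α : I → C ⟦ σ ⟧ᵀ) (δ : Directed (_⊑_ ⟦ σ ⟧ᵀ) α) (t : Term σ)
      → ((i : I) → R σ t (α i)) → R σ t (⨆ ⟦ σ ⟧ᵀ α δ)
  R-⨆ ι α δ t rel = lift (λ p → ∥∥-rec squash (λ { (i , q) →
    subst (λ v → t ~>* numeral v) (value-cong (𝓛-sup-ub α δ i q) q p) (lower (rel i) q) }) p)
  R-⨆ (τ ⇒ ρ) α δ s rel t e rte =
    R-⨆ ρ (λ i → proj₁ (α i) e) (Exp.dir-app ⟦ τ ⟧ᵀ ⟦ ρ ⟧ᵀ {α = α} δ e) (s · t)
        (λ i → rel i t e rte)

  R-iter : (σ : Ty) {f : Term (σ ⇒ σ)} {e : C ⟦ σ ⇒ σ ⟧ᵀ} → R (σ ⇒ σ) f e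
         → (n : ℕ) → R σ (Fix · f) (FixInterp.iter ⟦ σ ⟧ᵀ e n)
  R-iter σ {f} rf zero    = R-⊥ σ (Fix · f)
  R-iter σ {f} rf (suc n) = R-expand σ (~̃>⇒~>* (fix-red f)) (rf (Fix · f) _ (R-iter σ rf n))

  pred-numeral : (n : ℕ) → Pred · numeral n ~>* numeral (pred n)
  pred-numeral zero    = ~̃>⇒~>* pred-zero
  pred-numeral (suc n) = ~̃>⇒~>* (pred-suc n)

  ifz-numeral : {s t : Term ι} {x y : 𝓛 ℕ} → R ι s x → R ι t y
              → (n : ℕ) (d : isdefined (χ x y n))
              → Ifz · s · t · numeral n ~>* numeral (value (χ x y n) d)
  ifz-numeral {s} {t} rs rt zero    d = ~̃>⇒~>* (ifz-zero s t)   ⨾ lower rs d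
  ifz-numeral {s} {t} rs rt (suc n) d = ~̃>⇒~>* (ifz-suc s t n) ⨾ lower rt d

  fundamental : {σ : Ty} (t : Term σ) → R σ t ⟦ t ⟧
  fundamental Zero             = lift (λ _ → ∣ rfl ∣)
  fundamental Succ t d rt      = lift (λ p → ~>*-cong (Succ ·_) succ-cong (lower rt p))
  fundamental Pred t d rt      = lift (λ p →
    ~>*-cong (Pred ·_) pred-cong (lower rt p) ⨾ pred-numeral (value d p))
  fundamental Ifz s x rs t y rt r z rr = lift (λ { (p , d) →
    ~>*-cong (Ifz · s · t ·_) (ifz-cong s t) (lower rr p) ⨾ ifz-numeral rs rt (value z p) d })
  fundamental (K {σ}) s x rs t y rt = R-expand σ (~̃>⇒~>* (k-red s t)) rs
  fundamental (S {ρ = ρ}) f a rf g b rg t c rt =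
    R-expand ρ (~̃>⇒~>* (s-red f g t)) (rf t c rt (g · t) _ (rg t c rt))
  fundamental (Fix {σ}) f e rf =
    R-⨆ σ (FixInterp.iter ⟦ σ ⟧ᵀ e) (FixInterp.iter-dir ⟦ σ ⟧ᵀ e) (Fix · f) (R-iter σ rf)
  fundamental (s · t) = fundamental s t ⟦ t ⟧ (fundamental t)

lemma7p9 : (pt : PropTrunc) (fe : FunExt) (pe : PropExt)
         → {σ : Ty} (t : Term σ) → PCF.R pt fe pe σ t (PCF.⟦_⟧ pt fe pe t)
lemma7p9 pt fe pe = LogicalRelation.fundamental pt fe pe
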